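{- For every positive integer $n$, if $\delta(n)\ne 0$ then $\delta(n)\ge\delta(2)$. Equivalently, if $n$ is not a power of $3$ with positive exponent, then $\delta(n)\ge \delta(2)=2-3\log_3 2$.
   Context: For a positive integer $n$, its complexity $\|n\|$ is the least number of $1$'s needed to write $n$ using only the constant $1$, addition, multiplication, and parentheses (so $\|1\|=1$ and for $n>1$, $\|n\|=\min\{\|a\|+\|b\|: a,b<n,\ a+b=n \text{ or } ab=n\}$). The defect is $\delta(n)=\|n\|-3\log_3 n$. -}

module Defs where

open import Data.Nat using (ℕ; zero; suc; _+_; _*_; _≤_)
open import Data.Product using (_×_)

data Writable : ℕ → ℕ → Set where
  one : Writable 1 1
  add : ∀ {a b i j} → Writable a i → Writable b j → Writable (a + b) (i + j)
  mul : ∀ {a b i j} → Writable a i → Writable b j → Writable (a * b) (i + j)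

-- IsComplexity n k : k = ‖n‖, the least number of ones needed to write n.
IsComplexity : ℕ → ℕ → Set
IsComplexity n k = Writable n k × (∀ j → Writable n j → k ≤ j)

{-# OPTIONS --safe #-}
module Submission where

open import Defs
open import Data.Nat using (ℕ; suc; _+_; _*_; _^_; _≤_; z≤n; s≤s; NonZero)
open import Data.Nat.Properties
open import Data.Nat.Tactic.RingSolver using (solve-∀)
open import Data.Product using (_,_)
open import Relation.Binary.PropositionalEquality
open import Relation.Nullary using (contradiction)
open import Algebra.Properties.CommutativeSemigroup *-commutativeSemigroup using (x∙yz≈y∙xz)
open import Algebra.Properties.CommutativeSemiring.Exp +-*-commutativeSemiring using (^-distrib-*)

-- Both alternatives are preserved by products.
-- For a sum, a linear inequality k m ≤ l n (1 + b ≤ 2 b; 3 (1 + b) ≤ 4 b for b ≥ 3;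
-- 6 (a + b) ≤ 5 a b for a ≥ 3, b ≥ 2) bounds the cube of the sum by a multiple of the
-- cubes of the parts, and the factor 3 ^ i contributed by the ones of the other summand
-- absorbs that multiple.  The sums 1 + 1, 1 + 2 and 2 + 2 are checked directly;
-- 3 = 1 + 2 with three ones is where equality reappears.

-- The defect of an expression with j ones, j − 3 log₃ n, is either 0 or at least δ(2).
data DefectGap (n j : ℕ) : Set where
  zero-defect  : 3 ^ j ≡ n ^ 3 → DefectGap n j
  large-defect : 9 * n ^ 3 ≤ 8 * 3 ^ j → DefectGap n j

DefectGap⇒^3≤3^ : ∀ {n j} → DefectGap n j → n ^ 3 ≤ 3 ^ j
DefectGap⇒^3≤3^ (zero-defect eq) = ≤-reflexive (sym eq)
DefectGap⇒^3≤3^ {n} (large-defect bound) =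
  *-cancelˡ-≤ 8 (≤-trans (*-monoˡ-≤ (n ^ 3) (n≤1+n 8)) bound)

large-defect-≤ : ∀ {m N i j} → 9 * m ^ 3 ≤ 8 * N → N ≤ 3 ^ i * 3 ^ j → DefectGap m (i + j)
large-defect-≤ {m} {N} {i} {j} m≤N N≤3^i*3^j = large-defect (begin
  9 * m ^ 3           ≤⟨ m≤N ⟩
  8 * N               ≤⟨ *-monoʳ-≤ 8 N≤3^i*3^j ⟩
  8 * (3 ^ i * 3 ^ j) ≡⟨ cong (8 *_) (^-distribˡ-+-* 3 i j) ⟨
  8 * 3 ^ (i + j)     ∎)
  where open ≤-Reasoning

DefectGap-2⇒2≤ : ∀ {j} → DefectGap 2 j → 2 ≤ j
DefectGap-2⇒2≤ {0} (zero-defect ())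
DefectGap-2⇒2≤ {0} (large-defect bound) = contradiction bound (<⇒≱ (≤ᵇ⇒≤ 9 72 _))
DefectGap-2⇒2≤ {1} (zero-defect ())
DefectGap-2⇒2≤ {1} (large-defect bound) = contradiction bound (<⇒≱ (≤ᵇ⇒≤ 25 72 _))
DefectGap-2⇒2≤ {suc (suc j)} _ = s≤s (s≤s z≤n)

^3-*-≤ : ∀ {a b A B} → a ^ 3 ≤ A → b ^ 3 ≤ B → (a * b) ^ 3 ≤ A * B
^3-*-≤ {a} {b} a≤A b≤B = ≤-trans (≤-reflexive (^-distrib-* a b 3)) (*-mono-≤ a≤A b≤B)

cube-scale : ∀ k l s {m n} .{{_ : NonZero k}} →
             k * m ≤ l * n → 9 * l ^ 3 ≤ k ^ 3 * (8 * s) → 9 * m ^ 3 ≤ 8 * (s * n ^ 3)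
cube-scale k l s {m} {n} km≤ln coeff = *-cancelˡ-≤ (k ^ 3) {{m^n≢0 k 3}} (begin
  k ^ 3 * (9 * m ^ 3)         ≡⟨ x∙yz≈y∙xz (k ^ 3) 9 (m ^ 3) ⟩
  9 * (k ^ 3 * m ^ 3)         ≡⟨ cong (9 *_) (^-distrib-* k m 3) ⟨
  9 * (k * m) ^ 3             ≤⟨ *-monoʳ-≤ 9 (^-monoˡ-≤ 3 km≤ln) ⟩
  9 * (l * n) ^ 3             ≡⟨ cong (9 *_) (^-distrib-* l n 3) ⟩
  9 * (l ^ 3 * n ^ 3)         ≡⟨ *-assoc 9 (l ^ 3) (n ^ 3) ⟨
  9 * l ^ 3 * n ^ 3           ≤⟨ *-monoˡ-≤ (n ^ 3) coeff ⟩
  k ^ 3 * (8 * s) * n ^ 3     ≡⟨ *-assoc (k ^ 3) (8 * s) (n ^ 3) ⟩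
  k ^ 3 * (8 * s * n ^ 3)     ≡⟨ cong (k ^ 3 *_) (*-assoc 8 s (n ^ 3)) ⟩
  k ^ 3 * (8 * (s * n ^ 3))   ∎)
  where open ≤-Reasoning

1*[1+n]≤2*n : ∀ {n} → 1 ≤ n → 1 * (1 + n) ≤ 2 * n
1*[1+n]≤2*n {suc n} _ = subst (1 * (2 + n) ≤_) (eq n) (m≤m+n _ n)
  where
  eq : ∀ n → 1 * (2 + n) + n ≡ 2 * (1 + n)
  eq = solve-∀

3*[1+n]≤4*n : ∀ {n} → 3 ≤ n → 3 * (1 + n) ≤ 4 * n
3*[1+n]≤4*n (s≤s (s≤s (s≤s (z≤n {n})))) = subst (3 * (4 + n) ≤_) (eq n) (m≤m+n _ n)
  where
  eq : ∀ n → 3 * (4 + n) + n ≡ 4 * (3 + n)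
  eq = solve-∀

6*[m+n]≤5*[m*n] : ∀ {m n} → 3 ≤ m → 2 ≤ n → 6 * (m + n) ≤ 5 * (m * n)
6*[m+n]≤5*[m*n] (s≤s (s≤s (s≤s (z≤n {x})))) (s≤s (s≤s (z≤n {y}))) =
  subst (6 * ((3 + x) + (2 + y)) ≤_) (eq x y) (m≤m+n _ _)
  where
  eq : ∀ x y → 6 * ((3 + x) + (2 + y)) + (4 * x + 9 * y + 5 * (x * y))
             ≡ 5 * ((3 + x) * (2 + y))
  eq = solve-∀

DefectGap-* : ∀ {a b i j} → DefectGap a i → DefectGap b j → DefectGap (a * b) (i + j)
DefectGap-* {a} {b} {i} {j} (zero-defect eqa) (zero-defect eqb) = zero-defect (begin
  3 ^ (i + j)     ≡⟨ ^-distribˡ-+-* 3 i j ⟩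
  3 ^ i * 3 ^ j   ≡⟨ cong₂ _*_ eqa eqb ⟩
  a ^ 3 * b ^ 3   ≡⟨ ^-distrib-* a b 3 ⟨
  (a * b) ^ 3     ∎)
  where open ≡-Reasoning
DefectGap-* {a} {b} {i} {j} (large-defect 9a³≤) gb =
  large-defect-≤ {i = i} {j} (begin
    9 * (a * b) ^ 3        ≡⟨ cong (9 *_) (^-distrib-* a b 3) ⟩
    9 * (a ^ 3 * b ^ 3)    ≡⟨ *-assoc 9 (a ^ 3) (b ^ 3) ⟨
    9 * a ^ 3 * b ^ 3      ≤⟨ *-mono-≤ 9a³≤ (DefectGap⇒^3≤3^ gb) ⟩
    8 * 3 ^ i * 3 ^ j      ≡⟨ *-assoc 8 (3 ^ i) (3 ^ j) ⟩
    8 * (3 ^ i * 3 ^ j)    ∎) ≤-refl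
  where open ≤-Reasoning
DefectGap-* {a} {b} {i} {j} ga@(zero-defect _) gb@(large-defect _) =
  subst₂ DefectGap (*-comm b a) (+-comm j i) (DefectGap-* gb ga)

DefectGap-1+ : ∀ {b i j} → 1 ≤ b → 1 ≤ i → 1 ≤ j → DefectGap b j → DefectGap (1 + b) (i + j)
DefectGap-1+ {i = 0} _ () _ _
DefectGap-1+ {b} {suc (suc i)} {j} 1≤b _ _ gb =
  large-defect-≤ {i = 2 + i} {j} (cube-scale 1 2 9 {1 + b} {b} (1*[1+n]≤2*n 1≤b) ≤-refl)
    (*-mono-≤ (^-monoʳ-≤ 3 (m≤m+n 2 i)) (DefectGap⇒^3≤3^ gb))
DefectGap-1+ {1} {1} {j} _ _ 1≤j _ = large-defect (*-monoʳ-≤ 8 (^-monoʳ-≤ 3 (s≤s 1≤j)))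
DefectGap-1+ {2} {1} {1} _ _ _ gb = contradiction (DefectGap-2⇒2≤ gb) λ { (s≤s ()) }
DefectGap-1+ {2} {1} {2} _ _ _ _ = zero-defect refl
DefectGap-1+ {2} {1} {suc (suc (suc j))} _ _ _ _ =
  large-defect (≤-trans (≤ᵇ⇒≤ 243 648 _) (*-monoʳ-≤ 8 (^-monoʳ-≤ 3 (m≤m+n 4 j))))
DefectGap-1+ {b@(suc (suc (suc _)))} {1} {j} _ _ _ gb =
  large-defect-≤ {i = 1} {j}
    (cube-scale 3 4 3 {1 + b} {b} (3*[1+n]≤4*n (s≤s (s≤s (s≤s z≤n)))) (≤ᵇ⇒≤ _ _ _))
    (*-monoʳ-≤ 3 (DefectGap⇒^3≤3^ gb))

DefectGap-2+2 : ∀ {i j} → DefectGap 2 i → DefectGap 2 j → DefectGap 4 (i + j)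
DefectGap-2+2 gi gj = large-defect (≤-trans (≤ᵇ⇒≤ 576 648 _)
  (*-monoʳ-≤ 8 (^-monoʳ-≤ 3 (+-mono-≤ (DefectGap-2⇒2≤ gi) (DefectGap-2⇒2≤ gj)))))

DefectGap-+-3≤ : ∀ {a b i j} → 3 ≤ a → 2 ≤ b →
                 DefectGap a i → DefectGap b j → DefectGap (a + b) (i + j)
DefectGap-+-3≤ {a} {b} {i} {j} 3≤a 2≤b ga gb =
  large-defect-≤ {i = i} {j}
    (cube-scale 6 5 1 {a + b} {a * b} (6*[m+n]≤5*[m*n] 3≤a 2≤b) (≤ᵇ⇒≤ _ _ _))
    (≤-trans (≤-reflexive (*-identityˡ ((a * b) ^ 3)))
             (^3-*-≤ {a} {b} (DefectGap⇒^3≤3^ ga) (DefectGap⇒^3≤3^ gb)))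

DefectGap-+ : ∀ {a b i j} → 1 ≤ a → 1 ≤ b → 1 ≤ i → 1 ≤ j →
              DefectGap a i → DefectGap b j → DefectGap (a + b) (i + j)
DefectGap-+ {1} _ 1≤b 1≤i 1≤j _ gb = DefectGap-1+ 1≤b 1≤i 1≤j gb
DefectGap-+ {suc (suc a)} {1} {i} {j} _ _ 1≤i 1≤j ga _ =
  subst₂ DefectGap (+-comm 1 (2 + a)) (+-comm j i) (DefectGap-1+ (s≤s z≤n) 1≤j 1≤i ga)
DefectGap-+ {2} {2} _ _ _ _ ga gb = DefectGap-2+2 ga gb
DefectGap-+ {suc (suc (suc _))} {suc (suc _)} _ _ _ _ ga gb =
  DefectGap-+-3≤ (s≤s (s≤s (s≤s z≤n))) (s≤s (s≤s z≤n)) ga gb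
DefectGap-+ {2} {b@(suc (suc (suc _)))} {i} {j} _ _ _ _ ga gb =
  subst₂ DefectGap (+-comm b 2) (+-comm j i)
    (DefectGap-+-3≤ (s≤s (s≤s (s≤s z≤n))) (s≤s (s≤s z≤n)) gb ga)

Writable⇒1≤value : ∀ {n j} → Writable n j → 1 ≤ n
Writable⇒1≤value one         = ≤-refl
Writable⇒1≤value (add wa _)  = ≤-trans (Writable⇒1≤value wa) (m≤m+n _ _)
Writable⇒1≤value (mul wa wb) = *-mono-≤ (Writable⇒1≤value wa) (Writable⇒1≤value wb)

Writable⇒1≤ones : ∀ {n j} → Writable n j → 1 ≤ j
Writable⇒1≤ones one        = ≤-refl
Writable⇒1≤ones (add wa _) = ≤-trans (Writable⇒1≤ones wa) (m≤m+n _ _)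
Writable⇒1≤ones (mul wa _) = ≤-trans (Writable⇒1≤ones wa) (m≤m+n _ _)

Writable⇒DefectGap : ∀ {n j} → Writable n j → DefectGap n j
Writable⇒DefectGap one         = large-defect (≤ᵇ⇒≤ 9 24 _)
Writable⇒DefectGap (add wa wb) =
  DefectGap-+ (Writable⇒1≤value wa) (Writable⇒1≤value wb)
              (Writable⇒1≤ones wa) (Writable⇒1≤ones wb)
              (Writable⇒DefectGap wa) (Writable⇒DefectGap wb)
Writable⇒DefectGap (mul wa wb) = DefectGap-* (Writable⇒DefectGap wa) (Writable⇒DefectGap wb)

theorem5p2 : (n k : ℕ) → 1 ≤ n → IsComplexity n k →
    3 ^ k ≢ n ^ 3 → 9 * n ^ 3 ≤ 8 * 3 ^ k
theorem5p2 n k _ (w , _) δ≢0 with Writable⇒DefectGap w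
... | zero-defect δ≡0 = contradiction δ≡0 δ≢0
... | large-defect δ≥δ₂ = δ≥δ₂
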